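{- For all integers $k\ge 0$ and $m,t\ge 1$, there exists a graph $H'_{k,t}$ with $\binom{k+t}{t}$ vertices which is represented as the intersection graph of a $t$-thin $m$-shrinking sequence of intervals in $\mathbb{R}$, such that $H'_{k,t}$ has a spanning tree of depth at most $k$ that is decreasing with respect to the sizewise ordering. Furthermore, $H'_{k,t}$ is properly $(t+1)$-colorable.
   Context: Intervals are compact intervals of $\mathbb{R}$. The intersection graph of a finite set $S$ has vertex set $S$ with $u\neq v$ adjacent iff $u\cap v\neq\emptyset$; $S$ is $t$-thin if every point lies in the interior of at most $t$ members. A sequence of intervals $v_1,\ldots,v_n$ is $m$-shrinking if $\ell(v_i)>m\,\ell(v_{i+1})$ for $1\le i\le n-1$, where $\ell$ denotes length. A sizewise ordering $\prec$ satisfies: $u\prec v$ implies $\ell(u)\ge\ell(v)$. A decreasing spanning tree w.r.t. $\prec$ is a spanning tree rooted at the $\prec$-maximum vertex such that every path in the tree starting at the root has strictly $\prec$-decreasing vertices. -}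

module Defs where

open import Level using (0ℓ)
open import Data.Nat as ℕ using (ℕ; suc)
open import Data.Integer using (+_)
open import Data.Rational using (ℚ; _≤_; _<_; _-_; _*_; _/_)
open import Data.Fin using (Fin; toℕ)
open import Data.List using (List; length)
open import Data.List.Relation.Unary.All using (All)
open import Data.List.Relation.Unary.Unique.Propositional using (Unique)
open import Data.Product using (Σ; _×_)
open import Relation.Binary.PropositionalEquality using (_≡_)
open import Relation.Binary using (Rel; IsStrictTotalOrder)
open import Relation.Nullary using (¬_)

record Interval : Set where
  constructor [_,_]⟨_⟩
  field
    lo : ℚ
    hi : ℚ
    lo≤hi : lo ≤ hi
open Interval public

ℓ : Interval → ℚ
ℓ v = hi v - lo v

_∈I_ : ℚ → Interval → Set
x ∈I v = lo v ≤ x × x ≤ hi v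

_∈int_ : ℚ → Interval → Set
x ∈int v = lo v < x × x < hi v

Intersects : Interval → Interval → Set
Intersects u v = Σ ℚ λ x → x ∈I u × x ∈I v

Adj : ∀ {n} → (Fin n → Interval) → Fin n → Fin n → Set
Adj v i j = ¬ (i ≡ j) × Intersects (v i) (v j)

Thin : ℕ → ∀ {n} → (Fin n → Interval) → Set
Thin t {n} v = (x : ℚ) (S : List (Fin n)) → Unique S →
  All (λ i → x ∈int v i) S → length S ℕ.≤ t

Shrinking : ℕ → ∀ {n} → (Fin n → Interval) → Set
Shrinking m {n} v = (i j : Fin n) → toℕ j ≡ suc (toℕ i) →
  ((+ m) / 1) * ℓ (v j) < ℓ (v i)

record SizewiseOrdering {n} (v : Fin n → Interval) : Set₁ where
  field
    _≺_ : Rel (Fin n) 0ℓ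
    isSTO : IsStrictTotalOrder _≡_ _≺_
    sizewise : ∀ {i j} → i ≺ j → ℓ (v j) ≤ ℓ (v i)

record SpanningTree {n} (v : Fin n → Interval) : Set where
  field
    root : Fin n
    parent : Fin n → Fin n
    depth : Fin n → ℕ
    depth-root : depth root ≡ 0
    depth-parent : ∀ i → ¬ (i ≡ root) → depth i ≡ suc (depth (parent i))
    parent-adj : ∀ i → ¬ (i ≡ root) → Adj v (parent i) i
open SpanningTree public

DepthAtMost : ∀ {n} {v : Fin n → Interval} → ℕ → SpanningTree v → Set
DepthAtMost {n} k T = (i : Fin n) → depth T i ℕ.≤ k

-- decreasing w.r.t. ≺: root is the ≺-maximum and every root path is
-- strictly ≺-decreasing (equivalently each child is ≺ its parent)
Decreasing : ∀ {n} {v : Fin n → Interval} → SizewiseOrdering v → SpanningTree v → Set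
Decreasing {n} O T = ((i : Fin n) → ¬ (i ≡ root T) → i ≺ root T)
                   × ((i : Fin n) → ¬ (i ≡ root T) → i ≺ parent T i)
  where open SizewiseOrdering O

ProperColouring : ℕ → ∀ {n} → (Fin n → Interval) → Set
ProperColouring c {n} v = Σ (Fin n → Fin c) λ col →
  (i j : Fin n) → Adj v i j → ¬ (col i ≡ col j)

{-# OPTIONS --safe #-}
-- The intervals are built with natural-number endpoints, by induction along Pascal's rule
-- (k+t+2 choose t+1) = (k+t+1 choose t+1) + (k+t+1 choose t).  Every configuration has a
-- root, a unit segment lying to the right of all other segments.  The configuration for
-- (k+1, t+1) places a copy of the one for (k, t+1), scaled up by a large factor B, to the left
-- of a shifted copy of the one for (k+1, t), so that the scaled root touches the root of the
-- second copy and becomes its child.  Since B exceeds m times every length of the second copy,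
-- the shrinking property survives the junction; the scaled root is the only segment of the
-- first copy reaching into the second, so it alone needs a fresh thinness slot and a colour
-- avoided by the second copy.
module Submission where

open import Defs hiding (root; parent; depth; depth-root; depth-parent; parent-adj)
open import Data.Nat using (ℕ; suc; _≤_)
open import Data.Nat.Combinatorics using (_C_)
open import Data.Nat.Base using (_+_)
open import Data.Fin using (Fin)
open import Data.Product using (Σ; _×_)

open import Data.Nat using (zero; _*_; _<_; z≤n; s≤s; NonZero; >-nonZero)
open import Data.Nat.Properties
  using ( ≤-reflexive; ≤-trans; <-trans; ≤-<-trans; <-≤-trans; <⇒≤; <-irrefl; ≤-total
        ; m≤m+n; m≤n+m; m<m+n; m<n+m; n<1+n; m<n⇒m<1+n; +-suc; +-assoc; +-comm; +-cancelˡ-≡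
        ; +-monoʳ-≤; +-monoʳ-<; *-monoʳ-≤; *-monoʳ-<; *-identityʳ; *-distribˡ-+; *-commutativeSemigroup
        ; module ≤-Reasoning )
open import Data.Nat.Combinatorics using (nCn≡1; nCk+nC[k+1]≡[n+1]C[k+1])
import Data.Integer as ℤ
import Data.Integer.Properties as ℤₚ
open import Data.Rational as ℚ using (ℚ; mkℚ; *≤*; *<*)
import Data.Rational.Properties as ℚₚ
open import Data.Nat.Coprimality using (1-coprimeTo) renaming (sym to coprime-sym)
open import Algebra.Properties.AbelianGroup ℚₚ.+-0-abelianGroup using (xyx⁻¹≈y)
open import Algebra.Properties.CommutativeSemigroup *-commutativeSemigroup using (x∙yz≈y∙xz)
open import Data.Fin as Fin using (toℕ; _↑ˡ_; _↑ʳ_; punchIn; fromℕ<)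
open import Data.Fin.Properties
  using (toℕ-↑ˡ; toℕ-↑ʳ; toℕ<n; fromℕ<-injective; punchIn-injective; punchInᵢ≢i; injective⇒≤)
open import Data.List using (List; lookup)
open import Data.List.Relation.Unary.All as All using (All)
open import Data.List.Relation.Unary.Unique.Propositional using (Unique)
open import Data.List.Relation.Unary.AllPairs using (_∷_)
open import Data.List.Membership.Propositional.Properties using (∈-lookup)
open import Data.Product using (_,_)
open import Data.Sum as Sum using (_⊎_; inj₁; inj₂)
open import Data.Empty using (⊥-elim)
open import Function using (_∘_)
open import Function.Definitions using (Injective)
open import Relation.Binary using (IsStrictTotalOrder; tri<; tri≈; tri>)
open import Relation.Binary.PropositionalEquality
open import Relation.Nullary using (¬_; yes; no)

toℚ : ℕ → ℚ
toℚ n = mkℚ (ℤ.+ n) 0 (coprime-sym (1-coprimeTo n))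

+n/1≡toℚn : ∀ n → ℤ.+ n ℚ./ 1 ≡ toℚ n
+n/1≡toℚn n = ℚₚ.normalize-coprime (coprime-sym (1-coprimeTo n))

toℚ-+ : ∀ m n → toℚ (m + n) ≡ toℚ m ℚ.+ toℚ n
toℚ-+ m n = sym (trans (cong (ℚ._/ 1) (cong₂ ℤ._+_ (ℤₚ.*-identityʳ (ℤ.+ m)) (ℤₚ.*-identityʳ (ℤ.+ n))))
                       (+n/1≡toℚn (m + n)))

toℚ-* : ∀ m n → toℚ m ℚ.* toℚ n ≡ toℚ (m * n)
toℚ-* m n = trans (cong (ℚ._/ 1) (ℤₚ.+◃n≡+n (m * n))) (+n/1≡toℚn (m * n))

toℚ[m+n]-toℚm≡toℚn : ∀ m n → toℚ (m + n) ℚ.- toℚ m ≡ toℚ n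
toℚ[m+n]-toℚm≡toℚn m n = trans (cong (ℚ._- toℚ m) (toℚ-+ m n)) (xyx⁻¹≈y (toℚ m) (toℚ n))

toℚ-mono-≤ : ∀ {m n} → m ≤ n → toℚ m ℚ.≤ toℚ n
toℚ-mono-≤ {m} {n} m≤n =
  *≤* (subst₂ ℤ._≤_ (sym (ℤₚ.*-identityʳ (ℤ.+ m))) (sym (ℤₚ.*-identityʳ (ℤ.+ n))) (ℤ.+≤+ m≤n))

toℚ-mono-< : ∀ {m n} → m < n → toℚ m ℚ.< toℚ n
toℚ-mono-< {m} {n} m<n =
  *<* (subst₂ ℤ._<_ (sym (ℤₚ.*-identityʳ (ℤ.+ m))) (sym (ℤₚ.*-identityʳ (ℤ.+ n))) (ℤ.+<+ m<n))

record Segment : Set where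
  constructor ⟨_,_⟩
  field
    start len : ℕ

  end : ℕ
  end = start + len

open Segment public

Precedes StrictlyPrecedes Meets : Segment → Segment → Set
Precedes s t = end s ≤ start t
StrictlyPrecedes s t = end s < start t
Meets s t = start s ≤ end t × start t ≤ end s

InteriorDisjoint Disjoint : Segment → Segment → Set
InteriorDisjoint s t = Precedes s t ⊎ Precedes t s
Disjoint s t = StrictlyPrecedes s t ⊎ StrictlyPrecedes t s

start≤end : ∀ s → start s ≤ end s
start≤end s = m≤m+n (start s) (len s)

end≡start⇒Meets : ∀ {s t} → end s ≡ start t → Meets t s
end≡start⇒Meets {s} {t} e =
  ≤-reflexive (sym e) , ≤-trans (start≤end s) (≤-trans (≤-reflexive e) (start≤end t))

scale : ℕ → Segment → Segment
scale c s = ⟨ c * start s , c * len s ⟩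

end-scale : ∀ c s → end (scale c s) ≡ c * end s
end-scale c s = sym (*-distribˡ-+ c (start s) (len s))

scale-Precedes : ∀ c {s t} → Precedes s t → Precedes (scale c s) (scale c t)
scale-Precedes c {s} p = ≤-trans (≤-reflexive (end-scale c s)) (*-monoʳ-≤ c p)

scale-StrictlyPrecedes : ∀ c .{{_ : NonZero c}} {s t} →
                         StrictlyPrecedes s t → StrictlyPrecedes (scale c s) (scale c t)
scale-StrictlyPrecedes c {s} p = ≤-<-trans (≤-reflexive (end-scale c s)) (*-monoʳ-< c p)

scale-Meets : ∀ c {s t} → Meets s t → Meets (scale c s) (scale c t)
scale-Meets c {s} {t} (p , q) =
  ≤-trans (*-monoʳ-≤ c p) (≤-reflexive (sym (end-scale c t))) ,
  ≤-trans (*-monoʳ-≤ c q) (≤-reflexive (sym (end-scale c s)))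

scale-InteriorDisjoint : ∀ c {s t} → InteriorDisjoint s t → InteriorDisjoint (scale c s) (scale c t)
scale-InteriorDisjoint c {s} {t} = Sum.map (scale-Precedes c {s} {t}) (scale-Precedes c {t} {s})

scale-Disjoint : ∀ c .{{_ : NonZero c}} {s t} → Disjoint s t → Disjoint (scale c s) (scale c t)
scale-Disjoint c {s} {t} = Sum.map (scale-StrictlyPrecedes c {s} {t}) (scale-StrictlyPrecedes c {t} {s})

shift : ℕ → Segment → Segment
shift o s = ⟨ o + start s , len s ⟩

end-shift : ∀ o s → end (shift o s) ≡ o + end s
end-shift o s = +-assoc o (start s) (len s)

shift-Precedes : ∀ o {s t} → Precedes s t → Precedes (shift o s) (shift o t)
shift-Precedes o {s} p = ≤-trans (≤-reflexive (end-shift o s)) (+-monoʳ-≤ o p)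

shift-StrictlyPrecedes : ∀ o {s t} → StrictlyPrecedes s t → StrictlyPrecedes (shift o s) (shift o t)
shift-StrictlyPrecedes o {s} p = ≤-<-trans (≤-reflexive (end-shift o s)) (+-monoʳ-< o p)

shift-Meets : ∀ o {s t} → Meets s t → Meets (shift o s) (shift o t)
shift-Meets o {s} {t} (p , q) =
  ≤-trans (+-monoʳ-≤ o p) (≤-reflexive (sym (end-shift o t))) ,
  ≤-trans (+-monoʳ-≤ o q) (≤-reflexive (sym (end-shift o s)))

shift-InteriorDisjoint : ∀ o {s t} → InteriorDisjoint s t → InteriorDisjoint (shift o s) (shift o t)
shift-InteriorDisjoint o {s} {t} = Sum.map (shift-Precedes o {s} {t}) (shift-Precedes o {t} {s})

shift-Disjoint : ∀ o {s t} → Disjoint s t → Disjoint (shift o s) (shift o t)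
shift-Disjoint o {s} {t} = Sum.map (shift-StrictlyPrecedes o {s} {t}) (shift-StrictlyPrecedes o {t} {s})

toInterval : Segment → Interval
toInterval s = [ toℚ (start s) , toℚ (end s) ]⟨ toℚ-mono-≤ (start≤end s) ⟩

ℓ-toInterval : ∀ s → ℓ (toInterval s) ≡ toℚ (len s)
ℓ-toInterval s = toℚ[m+n]-toℚm≡toℚn (start s) (len s)

ℓ-toInterval-mono-< : ∀ s t → len s < len t → ℓ (toInterval s) ℚ.< ℓ (toInterval t)
ℓ-toInterval-mono-< s t p = subst₂ ℚ._<_ (sym (ℓ-toInterval s)) (sym (ℓ-toInterval t)) (toℚ-mono-< p)

toInterval-shrinks : ∀ m s t → m * len s < len t →
                     (ℤ.+ m ℚ./ 1) ℚ.* ℓ (toInterval s) ℚ.< ℓ (toInterval t)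
toInterval-shrinks m s t p = subst₂ ℚ._<_ (sym m·ℓs≡toℚ[m*len]) (sym (ℓ-toInterval t)) (toℚ-mono-< p)
  where
  m·ℓs≡toℚ[m*len] : (ℤ.+ m ℚ./ 1) ℚ.* ℓ (toInterval s) ≡ toℚ (m * len s)
  m·ℓs≡toℚ[m*len] = trans (cong₂ ℚ._*_ (+n/1≡toℚn m) (ℓ-toInterval s)) (toℚ-* m (len s))

Meets⇒Intersects : ∀ {s t} → Meets s t → Intersects (toInterval s) (toInterval t)
Meets⇒Intersects {s} {t} (sₗ≤tᵣ , tₗ≤sᵣ) with ≤-total (start s) (start t)
... | inj₁ s≤t =
  toℚ (start t) , (toℚ-mono-≤ s≤t , toℚ-mono-≤ tₗ≤sᵣ) , (ℚₚ.≤-refl , toℚ-mono-≤ (start≤end t))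
... | inj₂ t≤s =
  toℚ (start s) , (ℚₚ.≤-refl , toℚ-mono-≤ (start≤end s)) , (toℚ-mono-≤ t≤s , toℚ-mono-≤ sₗ≤tᵣ)

Intersects⇒¬StrictlyPrecedes : ∀ {s t} → Intersects (toInterval s) (toInterval t) → ¬ StrictlyPrecedes s t
Intersects⇒¬StrictlyPrecedes (x , (_ , x≤end) , (start≤x , _)) p =
  ℚₚ.<-irrefl refl (ℚₚ.<-≤-trans (toℚ-mono-< p) (ℚₚ.≤-trans start≤x x≤end))

Intersects⇒¬Disjoint : ∀ {s t} → Intersects (toInterval s) (toInterval t) → ¬ Disjoint s t
Intersects⇒¬Disjoint s∩t (inj₁ p) = Intersects⇒¬StrictlyPrecedes s∩t p
Intersects⇒¬Disjoint (x , x∈s , x∈t) (inj₂ p) = Intersects⇒¬StrictlyPrecedes (x , x∈t , x∈s) p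

∈int⇒¬Precedes : ∀ {x s t} → x ∈int toInterval s → x ∈int toInterval t → ¬ Precedes s t
∈int⇒¬Precedes (_ , x<end) (start<x , _) p =
  ℚₚ.<-irrefl refl (ℚₚ.<-≤-trans (ℚₚ.<-trans start<x x<end) (toℚ-mono-≤ p))

∈int⇒¬InteriorDisjoint : ∀ {x s t} → x ∈int toInterval s → x ∈int toInterval t → ¬ InteriorDisjoint s t
∈int⇒¬InteriorDisjoint x∈s x∈t (inj₁ p) = ∈int⇒¬Precedes x∈s x∈t p
∈int⇒¬InteriorDisjoint x∈s x∈t (inj₂ p) = ∈int⇒¬Precedes x∈t x∈s p

longer⇒≺ : ∀ {n} {v : Fin n → Interval} (O : SizewiseOrdering v) {i j} →
           ℓ (v j) ℚ.< ℓ (v i) → SizewiseOrdering._≺_ O i j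
longer⇒≺ O {i} {j} ℓj<ℓi with IsStrictTotalOrder.compare (SizewiseOrdering.isSTO O) i j
... | tri< i≺j _ _ = i≺j
... | tri≈ _ refl _ = ⊥-elim (ℚₚ.<-irrefl refl ℓj<ℓi)
... | tri> _ _ j≺i = ⊥-elim (ℚₚ.<-irrefl refl (ℚₚ.<-≤-trans ℓj<ℓi (SizewiseOrdering.sizewise O j≺i)))

lookup-injective : ∀ {A : Set} {xs : List A} → Unique xs → ∀ {i j} → lookup xs i ≡ lookup xs j → i ≡ j
lookup-injective (_ ∷ _) {Fin.zero} {Fin.zero} _ = refl
lookup-injective (x∉xs ∷ _) {Fin.zero} {Fin.suc j} e = ⊥-elim (All.lookup x∉xs (∈-lookup j) e)
lookup-injective (x∉xs ∷ _) {Fin.suc i} {Fin.zero} e = ⊥-elim (All.lookup x∉xs (∈-lookup i) (sym e))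
lookup-injective (_ ∷ unique) {Fin.suc i} {Fin.suc j} e = cong Fin.suc (lookup-injective unique e)

data Split (a b : ℕ) : Fin (a + b) → Set where
  left  : (i : Fin a) → Split a b (i ↑ˡ b)
  right : (j : Fin b) → Split a b (a ↑ʳ j)

split : ∀ a b (x : Fin (a + b)) → Split a b x
split zero b x = right x
split (suc a) b Fin.zero = left Fin.zero
split (suc a) b (Fin.suc x) with split a b x
... | left i = left (Fin.suc i)
... | right j = right j

split-↑ˡ : ∀ {a b} (i : Fin a) → split a b (i ↑ˡ b) ≡ left i
split-↑ˡ Fin.zero = refl
split-↑ˡ {suc a} {b} (Fin.suc i) rewrite split-↑ˡ {a} {b} i = refl

split-↑ʳ : ∀ a {b} (j : Fin b) → split a b (a ↑ʳ j) ≡ right j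
split-↑ʳ zero j = refl
split-↑ʳ (suc a) {b} j rewrite split-↑ʳ a {b} j = refl

caseSplit : ∀ {a b} {X : Set} → (Fin a → X) → (Fin b → X) → Fin (a + b) → X
caseSplit {a} {b} f g x with split a b x
... | left i = f i
... | right j = g j

toℕ-↑ˡ<toℕ-↑ʳ : ∀ {a b} (i : Fin a) (j : Fin b) → toℕ (i ↑ˡ b) < toℕ (a ↑ʳ j)
toℕ-↑ˡ<toℕ-↑ʳ {a} {b} i j = begin-strict
  toℕ (i ↑ˡ b)  ≡⟨ toℕ-↑ˡ i b ⟩
  toℕ i         <⟨ toℕ<n i ⟩
  a             ≤⟨ m≤m+n a (toℕ j) ⟩
  a + toℕ j     ≡⟨ toℕ-↑ʳ a j ⟨
  toℕ (a ↑ʳ j)  ∎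
  where open ≤-Reasoning

↑ˡ-successor : ∀ {a} b {i i′ : Fin a} → toℕ (i′ ↑ˡ b) ≡ suc (toℕ (i ↑ˡ b)) → toℕ i′ ≡ suc (toℕ i)
↑ˡ-successor b {i} {i′} e = trans (sym (toℕ-↑ˡ i′ b)) (trans e (cong suc (toℕ-↑ˡ i b)))

↑ʳ-successor : ∀ a {b} {j j′ : Fin b} → toℕ (a ↑ʳ j′) ≡ suc (toℕ (a ↑ʳ j)) → toℕ j′ ≡ suc (toℕ j)
↑ʳ-successor a {b} {j} {j′} e =
  +-cancelˡ-≡ a _ _ (begin
    a + toℕ j′          ≡⟨ toℕ-↑ʳ a j′ ⟨
    toℕ (a ↑ʳ j′)       ≡⟨ e ⟩
    suc (toℕ (a ↑ʳ j))  ≡⟨ cong suc (toℕ-↑ʳ a j) ⟩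
    suc (a + toℕ j)     ≡⟨ +-suc a (toℕ j) ⟨
    a + suc (toℕ j)     ∎)
  where open ≡-Reasoning

record Gadget (m k t : ℕ) : Set where
  field
    n                     : ℕ
    n≡[k+t]Ct             : n ≡ (k + t) C t
    segment               : Fin n → Segment
    root                  : Fin n
    len-root              : len (segment root) ≡ 1
    precedes-root         : ∀ i → i ≢ root → Precedes (segment i) (segment root)
    root-shortest         : ∀ i → i ≢ root → len (segment root) < len (segment i)
    shrinking             : ∀ i j → toℕ j ≡ suc (toℕ i) → m * len (segment j) < len (segment i)
    parent                : Fin n → Fin n
    depth                 : Fin n → ℕ
    depth-root            : depth root ≡ 0
    depth-parent          : ∀ i → i ≢ root → depth i ≡ suc (depth (parent i))
    depth≤k               : ∀ i → depth i ≤ k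
    parent-meets          : ∀ i → i ≢ root → Meets (segment (parent i)) (segment i)
    parent-shorter        : ∀ i → i ≢ root → len (segment (parent i)) < len (segment i)
    slot                  : Fin n → ℕ
    slot<t                : ∀ i → i ≢ root → slot i < t
    slot-interiorDisjoint : ∀ i j → i ≢ root → j ≢ root → i ≢ j → slot i ≡ slot j →
                            InteriorDisjoint (segment i) (segment j)
    colour                : Fin n → Fin (suc t)
    colour-disjoint       : ∀ i j → i ≢ j → colour i ≡ colour j → Disjoint (segment i) (segment j)

  1≤len : ∀ i → 1 ≤ len (segment i)
  1≤len i with i Fin.≟ root
  ... | yes refl = ≤-reflexive (sym len-root)
  ... | no i≢root = ≤-trans (≤-reflexive (sym len-root)) (<⇒≤ (root-shortest i i≢root))

  len≤end-root : ∀ i → len (segment i) ≤ end (segment root)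
  len≤end-root i with i Fin.≟ root
  ... | yes refl = m≤n+m (len (segment root)) (start (segment root))
  ... | no i≢root = ≤-trans (m≤n+m _ (start (segment i)))
                            (≤-trans (precedes-root i i≢root) (start≤end (segment root)))

singleton : ∀ {m k t} → 1 ≡ (k + t) C t → Gadget m k t
singleton 1≡ = record
  { n = 1 ; n≡[k+t]Ct = 1≡ ; segment = λ _ → ⟨ 0 , 1 ⟩ ; root = Fin.zero ; len-root = refl
  ; precedes-root = λ i i≢0 → ⊥-elim (i≢0 (only i))
  ; root-shortest = λ i i≢0 → ⊥-elim (i≢0 (only i))
  ; shrinking = λ { Fin.zero Fin.zero () }
  ; parent = λ i → i ; depth = λ _ → 0 ; depth-root = refl
  ; depth-parent = λ i i≢0 → ⊥-elim (i≢0 (only i))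
  ; depth≤k = λ _ → z≤n
  ; parent-meets = λ i i≢0 → ⊥-elim (i≢0 (only i))
  ; parent-shorter = λ i i≢0 → ⊥-elim (i≢0 (only i))
  ; slot = λ _ → 0
  ; slot<t = λ i i≢0 → ⊥-elim (i≢0 (only i))
  ; slot-interiorDisjoint = λ i _ i≢0 → ⊥-elim (i≢0 (only i))
  ; colour = λ _ → Fin.zero
  ; colour-disjoint = λ i j i≢j → ⊥-elim (i≢j (trans (only i) (sym (only j))))
  }
  where
  only : (i : Fin 1) → i ≡ Fin.zero
  only Fin.zero = refl

module Combine {m k t} (L : Gadget m k (suc t)) (R : Gadget m (suc k) t) where
  private
    module L = Gadget L
    module R = Gadget R

  Wᴸ Wᴿ Eᴿ gap B offset : ℕ
  Wᴸ = start (L.segment L.root)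
  Wᴿ = start (R.segment R.root)
  Eᴿ = end (R.segment R.root)
  gap = 2 + m * Eᴿ
  B = Wᴿ + gap
  -- Chosen so that the scaled root of L ends exactly where the root of R starts.
  offset = B * Wᴸ + gap

  1<B : 1 < B
  1<B = ≤-trans (s≤s (s≤s z≤n)) (m≤n+m gap _)

  instance
    B≢0 : NonZero B
    B≢0 = >-nonZero (<-trans (s≤s z≤n) 1<B)

  B≤B*len : ∀ i → B ≤ B * len (L.segment i)
  B≤B*len i = ≤-trans (≤-reflexive (sym (*-identityʳ B))) (*-monoʳ-≤ B (L.1≤len i))

  1<B*len : ∀ i → 1 < B * len (L.segment i)
  1<B*len i = <-≤-trans 1<B (B≤B*len i)

  m*len<B*len : ∀ i j → m * len (R.segment j) < B * len (L.segment i)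
  m*len<B*len i j = begin-strict
    m * len (R.segment j) ≤⟨ *-monoʳ-≤ m (R.len≤end-root j) ⟩
    m * Eᴿ                <⟨ m<n+m (m * Eᴿ) (s≤s z≤n) ⟩
    gap                   ≤⟨ m≤n+m gap Wᴿ ⟩
    B                     ≤⟨ B≤B*len i ⟩
    B * len (L.segment i) ∎
    where open ≤-Reasoning

  scaled-root-touches-root : end (scale B (L.segment L.root)) ≡ start (shift offset (R.segment R.root))
  scaled-root-touches-root = begin
    B * Wᴸ + B * len (L.segment L.root) ≡⟨ cong (λ l → B * Wᴸ + B * l) L.len-root ⟩
    B * Wᴸ + B * 1                      ≡⟨ cong (B * Wᴸ +_) (*-identityʳ B) ⟩
    B * Wᴸ + (Wᴿ + gap)                 ≡⟨ cong (B * Wᴸ +_) (+-comm Wᴿ gap) ⟩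
    B * Wᴸ + (gap + Wᴿ)                 ≡⟨ sym (+-assoc (B * Wᴸ) gap Wᴿ) ⟩
    offset + Wᴿ                         ∎
    where open ≡-Reasoning

  scaled-precedes-scaled-root : ∀ i → i ≢ L.root → Precedes (scale B (L.segment i)) (scale B (L.segment L.root))
  scaled-precedes-scaled-root i i≢root = scale-Precedes B {L.segment i} {L.segment L.root} (L.precedes-root i i≢root)

  scaled-before-shifted : ∀ i j → i ≢ L.root →
                          StrictlyPrecedes (scale B (L.segment i)) (shift offset (R.segment j))
  scaled-before-shifted i j i≢root =
    ≤-<-trans (scaled-precedes-scaled-root i i≢root)
              (<-≤-trans (m<m+n (B * Wᴸ) (s≤s z≤n)) (m≤m+n offset _))

  n : ℕ
  n = L.n + R.n

  root : Fin n
  root = L.n ↑ʳ R.root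

  segment : Fin n → Segment
  segment = caseSplit (scale B ∘ L.segment) (shift offset ∘ R.segment)

  parentᴸ : Fin L.n → Fin n
  parentᴸ i with i Fin.≟ L.root
  ... | yes _ = root
  ... | no _ = L.parent i ↑ˡ R.n

  parent : Fin n → Fin n
  parent = caseSplit parentᴸ ((L.n ↑ʳ_) ∘ R.parent)

  depth : Fin n → ℕ
  depth = caseSplit (suc ∘ L.depth) R.depth

  slotᴸ : Fin L.n → ℕ
  slotᴸ i with i Fin.≟ L.root
  ... | yes _ = t
  ... | no _ = L.slot i

  slot : Fin n → ℕ
  slot = caseSplit slotᴸ R.slot

  colour : Fin n → Fin (suc (suc t))
  colour = caseSplit L.colour (punchIn (L.colour L.root) ∘ R.colour)

  ↑ʳ-≢root : ∀ {j} → L.n ↑ʳ j ≢ root → j ≢ R.root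
  ↑ʳ-≢root x≢root j≡root = x≢root (cong (L.n ↑ʳ_) j≡root)

  n≡ : n ≡ (suc k + suc t) C suc t
  n≡ = begin
    L.n + R.n                                ≡⟨ cong₂ _+_ L.n≡[k+t]Ct R.n≡[k+t]Ct ⟩
    (k + suc t) C suc t + (suc k + t) C t    ≡⟨ cong (λ z → (k + suc t) C suc t + z C t) (sym (+-suc k t)) ⟩
    (k + suc t) C suc t + (k + suc t) C t    ≡⟨ +-comm ((k + suc t) C suc t) _ ⟩
    (k + suc t) C t + (k + suc t) C suc t    ≡⟨ nCk+nC[k+1]≡[n+1]C[k+1] (k + suc t) t ⟩
    (suc k + suc t) C suc t                  ∎
    where open ≡-Reasoning

  len-root : len (segment root) ≡ 1
  len-root rewrite split-↑ʳ L.n R.root = R.len-root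

  precedes-root : ∀ x → x ≢ root → Precedes (segment x) (segment root)
  precedes-root x x≢root with split L.n R.n x
  precedes-root x x≢root | left i rewrite split-↑ʳ L.n R.root with i Fin.≟ L.root
  ... | yes refl = ≤-reflexive scaled-root-touches-root
  ... | no i≢root = <⇒≤ (scaled-before-shifted i R.root i≢root)
  precedes-root x x≢root | right j rewrite split-↑ʳ L.n R.root =
    shift-Precedes offset {R.segment j} {R.segment R.root} (R.precedes-root j (↑ʳ-≢root x≢root))

  root-shortest : ∀ x → x ≢ root → len (segment root) < len (segment x)
  root-shortest x x≢root with split L.n R.n x
  ... | left i rewrite split-↑ʳ L.n R.root = ≤-<-trans (≤-reflexive R.len-root) (1<B*len i)
  ... | right j rewrite split-↑ʳ L.n R.root = R.root-shortest j (↑ʳ-≢root x≢root)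

  shrinking : ∀ x y → toℕ y ≡ suc (toℕ x) → m * len (segment y) < len (segment x)
  shrinking x y y≡1+x with split L.n R.n x | split L.n R.n y
  ... | left i | left i′ =
    ≤-<-trans (≤-reflexive (x∙yz≈y∙xz m B _)) (*-monoʳ-< B (L.shrinking i i′ (↑ˡ-successor R.n y≡1+x)))
  ... | left i | right j = m*len<B*len i j
  ... | right j | left i = ⊥-elim (<-irrefl refl (<-trans (toℕ-↑ˡ<toℕ-↑ʳ i j) (≤-reflexive (sym y≡1+x))))
  ... | right j | right j′ = R.shrinking j j′ (↑ʳ-successor L.n y≡1+x)

  depth-root : depth root ≡ 0
  depth-root rewrite split-↑ʳ L.n R.root = R.depth-root

  depth-parent : ∀ x → x ≢ root → depth x ≡ suc (depth (parent x))
  depth-parent x x≢root with split L.n R.n x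
  depth-parent x x≢root | left i with i Fin.≟ L.root
  ... | yes refl rewrite split-↑ʳ L.n R.root = cong suc (trans L.depth-root (sym R.depth-root))
  ... | no i≢root rewrite split-↑ˡ {b = R.n} (L.parent i) = cong suc (L.depth-parent i i≢root)
  depth-parent x x≢root | right j rewrite split-↑ʳ L.n (R.parent j) = R.depth-parent j (↑ʳ-≢root x≢root)

  depth≤1+k : ∀ x → depth x ≤ suc k
  depth≤1+k x with split L.n R.n x
  ... | left i = s≤s (L.depth≤k i)
  ... | right j = R.depth≤k j

  parent-meets : ∀ x → x ≢ root → Meets (segment (parent x)) (segment x)
  parent-meets x x≢root with split L.n R.n x
  parent-meets x x≢root | left i with i Fin.≟ L.root
  ... | yes refl rewrite split-↑ʳ L.n R.root = end≡start⇒Meets scaled-root-touches-root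
  ... | no i≢root rewrite split-↑ˡ {b = R.n} (L.parent i) = scale-Meets B (L.parent-meets i i≢root)
  parent-meets x x≢root | right j rewrite split-↑ʳ L.n (R.parent j) =
    shift-Meets offset (R.parent-meets j (↑ʳ-≢root x≢root))

  parent-shorter : ∀ x → x ≢ root → len (segment (parent x)) < len (segment x)
  parent-shorter x x≢root with split L.n R.n x
  parent-shorter x x≢root | left i with i Fin.≟ L.root
  ... | yes refl rewrite split-↑ʳ L.n R.root = ≤-<-trans (≤-reflexive R.len-root) (1<B*len L.root)
  ... | no i≢root rewrite split-↑ˡ {b = R.n} (L.parent i) = *-monoʳ-< B (L.parent-shorter i i≢root)
  parent-shorter x x≢root | right j rewrite split-↑ʳ L.n (R.parent j) = R.parent-shorter j (↑ʳ-≢root x≢root)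

  slot<1+t : ∀ x → x ≢ root → slot x < suc t
  slot<1+t x x≢root with split L.n R.n x
  slot<1+t x x≢root | left i with i Fin.≟ L.root
  ... | yes _ = n<1+n t
  ... | no i≢root = L.slot<t i i≢root
  slot<1+t x x≢root | right j = m<n⇒m<1+n (R.slot<t j (↑ʳ-≢root x≢root))

  slot-interiorDisjointᴸᴿ : ∀ i j → j ≢ R.root → slotᴸ i ≡ R.slot j →
                            InteriorDisjoint (scale B (L.segment i)) (shift offset (R.segment j))
  slot-interiorDisjointᴸᴿ i j j≢root same with i Fin.≟ L.root
  ... | yes _ = ⊥-elim (<-irrefl (sym same) (R.slot<t j j≢root))
  ... | no i≢root = inj₁ (<⇒≤ (scaled-before-shifted i j i≢root))

  slot-interiorDisjoint : ∀ x y → x ≢ root → y ≢ root → x ≢ y → slot x ≡ slot y →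
                          InteriorDisjoint (segment x) (segment y)
  slot-interiorDisjoint x y x≢root y≢root x≢y same with split L.n R.n x | split L.n R.n y
  slot-interiorDisjoint x y x≢root y≢root x≢y same | left i | left i′
    with i Fin.≟ L.root | i′ Fin.≟ L.root
  ... | yes refl | yes refl = ⊥-elim (x≢y refl)
  ... | yes refl | no i′≢root = inj₂ (scaled-precedes-scaled-root i′ i′≢root)
  ... | no i≢root | yes refl = inj₁ (scaled-precedes-scaled-root i i≢root)
  ... | no i≢root | no i′≢root =
    scale-InteriorDisjoint B (L.slot-interiorDisjoint i i′ i≢root i′≢root (x≢y ∘ cong (_↑ˡ R.n)) same)
  slot-interiorDisjoint x y x≢root y≢root x≢y same | left i | right j =
    slot-interiorDisjointᴸᴿ i j (↑ʳ-≢root y≢root) same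
  slot-interiorDisjoint x y x≢root y≢root x≢y same | right j | left i =
    Sum.swap (slot-interiorDisjointᴸᴿ i j (↑ʳ-≢root x≢root) (sym same))
  slot-interiorDisjoint x y x≢root y≢root x≢y same | right j | right j′ =
    shift-InteriorDisjoint offset
      (R.slot-interiorDisjoint j j′ (↑ʳ-≢root x≢root) (↑ʳ-≢root y≢root) (x≢y ∘ cong (L.n ↑ʳ_)) same)

  colour-disjointᴸᴿ : ∀ i j → L.colour i ≡ punchIn (L.colour L.root) (R.colour j) →
                      Disjoint (scale B (L.segment i)) (shift offset (R.segment j))
  colour-disjointᴸᴿ i j same with i Fin.≟ L.root
  ... | yes refl = ⊥-elim (punchInᵢ≢i (L.colour L.root) (R.colour j) (sym same))
  ... | no i≢root = inj₁ (scaled-before-shifted i j i≢root)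

  colour-disjoint : ∀ x y → x ≢ y → colour x ≡ colour y → Disjoint (segment x) (segment y)
  colour-disjoint x y x≢y same with split L.n R.n x | split L.n R.n y
  ... | left i | left i′ = scale-Disjoint B (L.colour-disjoint i i′ (x≢y ∘ cong (_↑ˡ R.n)) same)
  ... | left i | right j = colour-disjointᴸᴿ i j same
  ... | right j | left i = Sum.swap (colour-disjointᴸᴿ i j (sym same))
  ... | right j | right j′ =
    shift-Disjoint offset (R.colour-disjoint j j′ (x≢y ∘ cong (L.n ↑ʳ_)) (punchIn-injective _ _ _ same))

  gadget : Gadget m (suc k) (suc t)
  gadget = record
    { n = n ; n≡[k+t]Ct = n≡ ; segment = segment ; root = root ; len-root = len-root
    ; precedes-root = precedes-root ; root-shortest = root-shortest ; shrinking = shrinking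
    ; parent = parent ; depth = depth ; depth-root = depth-root ; depth-parent = depth-parent
    ; depth≤k = depth≤1+k ; parent-meets = parent-meets ; parent-shorter = parent-shorter
    ; slot = slot ; slot<t = slot<1+t ; slot-interiorDisjoint = slot-interiorDisjoint
    ; colour = colour ; colour-disjoint = colour-disjoint
    }

gadget : ∀ m k t → Gadget m k t
gadget m zero t = singleton (sym (nCn≡1 t))
gadget m (suc k) zero = singleton refl
gadget m (suc k) (suc t) = Combine.gadget (gadget m k (suc t)) (gadget m (suc k) t)

IntervalRepresentation : (k m t N : ℕ) → Set₁
IntervalRepresentation k m t N =
  Σ (Fin N → Interval) λ v →
    Thin t v × Shrinking m v
    × ((O : SizewiseOrdering v) → Σ (SpanningTree v) λ T → DepthAtMost k T × Decreasing O T)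
    × ProperColouring (suc t) v

module Realise {m k t} (G : Gadget m k (suc t)) where
  private
    module G = Gadget G

  v : Fin G.n → Interval
  v = toInterval ∘ G.segment

  -- The root lies to the right of every other segment, so it can share slot zero.
  slot : Fin G.n → Fin (suc t)
  slot i with i Fin.≟ G.root
  ... | yes _ = Fin.zero
  ... | no i≢root = fromℕ< (G.slot<t i i≢root)

  slot-interiorDisjoint : ∀ {i j} → i ≢ j → slot i ≡ slot j → InteriorDisjoint (G.segment i) (G.segment j)
  slot-interiorDisjoint {i} {j} i≢j same with i Fin.≟ G.root | j Fin.≟ G.root
  ... | yes refl | yes refl = ⊥-elim (i≢j refl)
  ... | yes refl | no j≢root = inj₂ (G.precedes-root j j≢root)
  ... | no i≢root | yes refl = inj₁ (G.precedes-root i i≢root)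
  ... | no i≢root | no j≢root =
    G.slot-interiorDisjoint i j i≢root j≢root i≢j (fromℕ<-injective _ _ _ _ same)

  thin : Thin (suc t) v
  thin x S unique inside = injective⇒≤ slot∘lookup-injective
    where
    x∈S : ∀ a → x ∈int v (lookup S a)
    x∈S a = All.lookup inside (∈-lookup a)

    slot∘lookup-injective : Injective _≡_ _≡_ (slot ∘ lookup S)
    slot∘lookup-injective {a} {b} same with a Fin.≟ b
    ... | yes a≡b = a≡b
    ... | no a≢b = ⊥-elim (∈int⇒¬InteriorDisjoint (x∈S a) (x∈S b)
                             (slot-interiorDisjoint (a≢b ∘ lookup-injective unique) same))

  shrinking : Shrinking m v
  shrinking i j j≡1+i = toInterval-shrinks m (G.segment j) (G.segment i) (G.shrinking i j j≡1+i)

  parent≢ : ∀ i → i ≢ G.root → G.parent i ≢ i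
  parent≢ i i≢root e = <-irrefl (cong (len ∘ G.segment) e) (G.parent-shorter i i≢root)

  tree : SpanningTree v
  tree = record
    { root = G.root ; parent = G.parent ; depth = G.depth
    ; depth-root = G.depth-root ; depth-parent = G.depth-parent
    ; parent-adj = λ i i≢root → parent≢ i i≢root , Meets⇒Intersects (G.parent-meets i i≢root)
    }

  decreasing : (O : SizewiseOrdering v) → Decreasing O tree
  decreasing O = (λ i i≢root → longer-segment⇒≺ (G.root-shortest i i≢root))
               , (λ i i≢root → longer-segment⇒≺ (G.parent-shorter i i≢root))
    where
    open SizewiseOrdering O using (_≺_)
    longer-segment⇒≺ : ∀ {i j} → len (G.segment j) < len (G.segment i) → i ≺ j
    longer-segment⇒≺ {i} {j} p = longer⇒≺ O (ℓ-toInterval-mono-< (G.segment j) (G.segment i) p)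

  colouring : ProperColouring (suc (suc t)) v
  colouring = G.colour , λ i j (i≢j , i∩j) same → Intersects⇒¬Disjoint i∩j (G.colour-disjoint i j i≢j same)

  representation : IntervalRepresentation k m (suc t) G.n
  representation = v , thin , shrinking , (λ O → tree , G.depth≤k , decreasing O) , colouring

lemma13 : (k m t : ℕ) → 1 ≤ m → 1 ≤ t →
    Σ (Fin ((k + t) C t) → Interval) λ v →
      Thin t v × Shrinking m v
      × ((O : SizewiseOrdering v) →
           Σ (SpanningTree v) λ T → DepthAtMost k T × Decreasing O T)
      × ProperColouring (suc t) v
lemma13 k m (suc t) _ _ =
  subst (IntervalRepresentation k m (suc t)) (Gadget.n≡[k+t]Ct G) (Realise.representation G)
  where
  G = gadget m k (suc t)
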